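{- Let $\phi$ be a set of UTVPI constraints whose constraint graph $G_\phi$ contains no negative weight cycle (equivalently, $\phi$ is satisfiable over $\mathbb{Q}$). Then $\phi$ is unsatisfiable over $\mathbb{Z}$ if and only if there is a vertex $v$ of $G_\phi$ with $\rho(v)+\rho(-v)<0$.
   Context: A UTVPI constraint is $ax+by\le d$ with $x,y$ integer variables, $a,b\in\{ -1,0,1\}$ and $d\in\mathbb{Z}$. The constraint graph $G_\phi$ is a weighted directed graph. It has two vertices $x^+,x^-$ for each variable $x$. Write $-x^+:=x^-$ and $-x^-:=x^+$. For each constraint of $\phi$ it contains the following edges: - $x-y\le d$ gives $y^+\xrightarrow{d}x^+$ and $x^-\xrightarrow{d}y^-$; - $x+y\le d$ gives $y^-\xrightarrow{d}x^+$ and $x^-\xrightarrow{d}y^+$; - $-x-y\le d$ gives $y^+\xrightarrow{d}x^-$ and $x^+\xrightarrow{d}y^-$; - $x\le d$ gives $x^-\xrightarrow{2d}x^+$; - $-x\le d$ gives $x^+\xrightarrow{2d}x^-$. For a graph without negative weight cycles, $wSP(u,v)$ is the minimum weight of a path from $u$ to $v$, or $+\infty$ if none exists. The bounds function is $\rho(u)=\lfloor wSP(u,-u)/2\rfloor$. -}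

module Defs where

open import Data.Nat using (ℕ)
open import Data.Fin using (Fin)
open import Data.Integer using (ℤ; +_; _+_; _*_; _≤_; _<_)
open import Data.List using (List; []; _∷_; concatMap)
open import Data.List.Membership.Propositional using (_∈_)
open import Data.List.Relation.Unary.All using (All)
open import Data.Product using (Σ; ∃; _×_; _,_)
open import Relation.Binary.PropositionalEquality using (_≢_)

-- A UTVPI constraint  a x + b y ≤ d  over variables Fin n, a,b ∈ {-1,0,1},
-- not both zero.  The forms are exactly those listed in the paper
-- (−x + y ≤ d is  y − x ≤ d, i.e. diff y x d).
data Constraint (n : ℕ) : Set where
  diff   : (x y : Fin n) → x ≢ y → ℤ → Constraint n
  sum    : (x y : Fin n) → x ≢ y → ℤ → Constraint n
  negsum : (x y : Fin n) → x ≢ y → ℤ → Constraint n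
  upper  : (x : Fin n) → ℤ → Constraint n
  lower  : (x : Fin n) → ℤ → Constraint n

_⊨_ : ∀ {n} → (Fin n → ℤ) → Constraint n → Set
σ ⊨ diff x y _ d   = σ x + Data.Integer.- σ y ≤ d
σ ⊨ sum x y _ d    = σ x + σ y ≤ d
σ ⊨ negsum x y _ d = Data.Integer.- σ x + Data.Integer.- σ y ≤ d
σ ⊨ upper x d      = σ x ≤ d
σ ⊨ lower x d      = Data.Integer.- σ x ≤ d

SatZ : ∀ {n} → List (Constraint n) → Set
SatZ {n} φ = Σ (Fin n → ℤ) λ σ → All (σ ⊨_) φ

data Vertex (n : ℕ) : Set where
  pos : Fin n → Vertex n
  neg : Fin n → Vertex n

co : ∀ {n} → Vertex n → Vertex n
co (pos x) = neg x
co (neg x) = pos x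

record Edge (n : ℕ) : Set where
  constructor _⟶[_]_
  field
    src : Vertex n
    wt  : ℤ
    tgt : Vertex n

edgesOf : ∀ {n} → Constraint n → List (Edge n)
edgesOf (diff x y _ d)   = (pos y ⟶[ d ] pos x) ∷ (neg x ⟶[ d ] neg y) ∷ []
edgesOf (sum x y _ d)    = (neg y ⟶[ d ] pos x) ∷ (neg x ⟶[ d ] pos y) ∷ []
edgesOf (negsum x y _ d) = (pos y ⟶[ d ] neg x) ∷ (pos x ⟶[ d ] neg y) ∷ []
edgesOf (upper x d)      = (neg x ⟶[ + 2 * d ] pos x) ∷ []
edgesOf (lower x d)      = (pos x ⟶[ + 2 * d ] neg x) ∷ []

edges : ∀ {n} → List (Constraint n) → List (Edge n)
edges φ = concatMap edgesOf φ

data Path {n : ℕ} (φ : List (Constraint n)) : Vertex n → Vertex n → Set where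
  []  : ∀ {u} → Path φ u u
  _∷_ : ∀ {u d w v} → (u ⟶[ d ] w) ∈ edges φ → Path φ w v → Path φ u v

weight : ∀ {n} {φ : List (Constraint n)} {u v} → Path φ u v → ℤ
weight [] = + 0
weight (_∷_ {d = d} _ p) = d + weight p

NoNegCycle : ∀ {n} → List (Constraint n) → Set
NoNegCycle {n} φ = ∀ (u : Vertex n) (p : Path φ u u) → + 0 ≤ weight p

-- wSP(u,v) = w  (finite): w is the minimum weight of a path from u to v.
-- (wSP(u,v) = +∞ exactly when no such w exists, i.e. no path.)
IsWSP : ∀ {n} → List (Constraint n) → Vertex n → Vertex n → ℤ → Set
IsWSP φ u v w = (Σ (Path φ u v) λ p → weight p ≡ w)
              × (∀ (p : Path φ u v) → w ≤ weight p)
  where open import Relation.Binary.PropositionalEquality using (_≡_)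

IsFloorHalf : ℤ → ℤ → Set
IsFloorHalf w r = + 2 * r ≤ w × w < + 2 * r + + 2

-- ρ(u) = r (finite): r = ⌊ wSP(u,-u) / 2 ⌋ with wSP(u,-u) finite.
-- ρ(u) = +∞ exactly when no such r exists.
IsRho : ∀ {n} → List (Constraint n) → Vertex n → ℤ → Set
IsRho φ u r = ∃ λ w → IsWSP φ u (co u) w × IsFloorHalf w r

module Submission where

-- An integer solution σ gives each vertex a potential
-- (x⁺ ↦ σ x, x⁻ ↦ -σ x) that rises by at most d along every edge of weight
-- d, so every path v → -v weighs at least -2·val σ v; hence ρ(v) ≥ -val σ v
-- and ρ(-v) ≥ val σ v, i.e. ρ(v) + ρ(-v) ≥ 0.
--
-- Call a graph consistent when it is
-- symmetric under (a →d b) ↦ (-b →d -a), has no negative cycle, and is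
-- tight: ⌊w(p)/2⌋ + ⌊w(q)/2⌋ ≥ 0 for all walks p : v → -v, q : -v → v.
-- Adding a bound edge u →2k -u that closes no negative cycle preserves
-- consistency (module AddBound), so each variable can be pinned to an
-- integer value in turn, and the pins of the final graph form an integer
-- solution.  Shortest walks exist and can be computed (by induction on the
-- edge list), so unless some vertex already has ρ(v) + ρ(-v) < 0, the
-- constraint graph is consistent and φ is satisfiable.

open import Defs
open import Data.Nat using (ℕ; zero; suc)
open import Data.Integer
  using (ℤ; +_; _+_; _*_; -_; _-_; _≤_; _<_; _≤?_; _<?_; _/ℕ_)
  renaming (suc to sucℤ)
open import Data.Integer.Properties
open import Data.Integer.DivMod using ([n/ℕd]*d≤n; n<s[n/ℕd]*d)
open import Data.Integer.Tactic.RingSolver using (solve-∀)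
open import Data.Fin as Fin using (Fin)
open import Data.List using (List; []; _∷_; allFin)
open import Data.List.Membership.Propositional using (_∈_; find; lose)
open import Data.List.Membership.Propositional.Properties
  using (∈-allFin; ∈-concatMap⁺; ∈-concatMap⁻)
open import Data.List.Relation.Unary.Any using (here; there)
open import Data.List.Relation.Unary.All as All using (All)
open import Data.Product using (Σ; ∃; _×_; _,_; proj₁; proj₂)
open import Data.Sum using (_⊎_; inj₁; inj₂; [_,_]′)
open import Data.Empty using (⊥-elim)
open import Function using (_∘_)
open import Function.Bundles using (_⇔_; mk⇔)
open import Relation.Nullary using (¬_; yes; no)
open import Relation.Binary.Definitions using (DecidableEquality)
open import Relation.Binary.PropositionalEquality

private variable
  n : ℕ
  a a′ b b′ c u v : Vertex n
  E : List (Edge n)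

⌊_/2⌋ : ℤ → ℤ
⌊ w /2⌋ = w /ℕ 2

floorHalf : ∀ w → IsFloorHalf w ⌊ w /2⌋
floorHalf w = below , above
  where
  below : + 2 * ⌊ w /2⌋ ≤ w
  below = subst (_≤ w) (*-comm ⌊ w /2⌋ (+ 2)) ([n/ℕd]*d≤n w 2)
  above : w < + 2 * ⌊ w /2⌋ + + 2
  above = subst (w <_) (sucTwice ⌊ w /2⌋) (n<s[n/ℕd]*d w 2)
    where
    sucTwice : ∀ q → (+ 1 + q) * + 2 ≡ + 2 * q + + 2
    sucTwice = solve-∀

floorHalf-greatest : ∀ {w r m} → IsFloorHalf w r → + 2 * m ≤ w → m ≤ r
floorHalf-greatest {w} {r} {m} (_ , w<2r+2) 2m≤w = ≮⇒≥ λ r<m → <⇒≱ w<2r+2 (begin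
  + 2 * r + + 2  ≡⟨ twiceSuc r ⟩
  + 2 * sucℤ r   ≤⟨ *-monoˡ-≤-nonNeg (+ 2) (i<j⇒suc[i]≤j r<m) ⟩
  + 2 * m        ≤⟨ 2m≤w ⟩
  w              ∎)
  where
  open ≤-Reasoning
  twiceSuc : ∀ r → + 2 * r + + 2 ≡ + 2 * (+ 1 + r)
  twiceSuc = solve-∀

⌊/2⌋-greatest : ∀ {m} w → + 2 * m ≤ w → m ≤ ⌊ w /2⌋
⌊/2⌋-greatest w = floorHalf-greatest (floorHalf w)

⌊/2⌋-mono : ∀ {v w} → v ≤ w → ⌊ v /2⌋ ≤ ⌊ w /2⌋
⌊/2⌋-mono {v} {w} v≤w = ⌊/2⌋-greatest w (≤-trans (proj₁ (floorHalf v)) v≤w)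

0≤-sum : ∀ {x y a b} → + 0 ≤ x + y → x ≤ a → y ≤ b → + 0 ≤ a + b
0≤-sum 0≤x+y x≤a y≤b = ≤-trans 0≤x+y (+-mono-≤ x≤a y≤b)

≤-+ˡ : ∀ {c} x → + 0 ≤ c → x ≤ c + x
≤-+ˡ x 0≤c = ≤-trans (≤-reflexive (sym (+-identityˡ x))) (+-monoˡ-≤ x 0≤c)

infixr 5 _∷ᵂ_ _++ᵂ_

data Walk (E : List (Edge n)) : Vertex n → Vertex n → Set where
  []ᵂ  : Walk E a a
  _∷ᵂ_ : ∀ {d w} → (a ⟶[ d ] w) ∈ E → Walk E w b → Walk E a b

wt : Walk E a b → ℤ
wt []ᵂ = + 0
wt (_∷ᵂ_ {d = d} _ p) = d + wt p

_++ᵂ_ : Walk E a b → Walk E b c → Walk E a c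
[]ᵂ      ++ᵂ q = q
(m ∷ᵂ p) ++ᵂ q = m ∷ᵂ (p ++ᵂ q)

wt-++ : (p : Walk E a b) (q : Walk E b c) → wt (p ++ᵂ q) ≡ wt p + wt q
wt-++ []ᵂ q = sym (+-identityˡ (wt q))
wt-++ (_∷ᵂ_ {d = d} _ p) q =
  trans (cong (λ z → d + z) (wt-++ p q)) (sym (+-assoc d (wt p) (wt q)))

weaken : ∀ {e} → Walk E a b → Walk (e ∷ E) a b
weaken []ᵂ = []ᵂ
weaken (m ∷ᵂ p) = there m ∷ᵂ weaken p

wt-weaken : ∀ {e} (p : Walk E a b) → wt (weaken {e = e} p) ≡ wt p
wt-weaken []ᵂ = refl
wt-weaken (_∷ᵂ_ {d = d} _ p) = cong (λ z → d + z) (wt-weaken p)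

retarget : a ≡ a′ → b ≡ b′ → Walk E a b → Walk E a′ b′
retarget refl refl p = p

wt-retarget : (eqa : a ≡ a′) (eqb : b ≡ b′) (p : Walk E a b) →
              wt (retarget eqa eqb p) ≡ wt p
wt-retarget refl refl p = refl

NoNeg : List (Edge n) → Set
NoNeg E = ∀ v (p : Walk E v v) → + 0 ≤ wt p

noNeg-tail : ∀ {e} → NoNeg (e ∷ E) → NoNeg E
noNeg-tail noNeg v p = subst (+ 0 ≤_) (wt-weaken p) (noNeg v (weaken p))

Least : (A : Set) → (A → ℤ) → Set
Least A f = (Σ A λ x → ∀ y → f x ≤ f y) ⊎ ¬ A

module _ {A B : Set} {f : A → ℤ} {g : B → ℤ} where

  least-⊎ : Least A f → Least B g → Least (A ⊎ B) [ f , g ]′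
  least-⊎ (inj₁ (x , min-x)) (inj₁ (y , min-y)) with f x ≤? g y
  ... | yes x≤y = inj₁ (inj₁ x ,
          λ { (inj₁ x′) → min-x x′ ; (inj₂ y′) → ≤-trans x≤y (min-y y′) })
  ... | no  x≰y = inj₁ (inj₂ y ,
          λ { (inj₁ x′) → ≤-trans (<⇒≤ (≰⇒> x≰y)) (min-x x′) ; (inj₂ y′) → min-y y′ })
  least-⊎ (inj₁ (x , min-x)) (inj₂ ¬B) =
    inj₁ (inj₁ x , λ { (inj₁ x′) → min-x x′ ; (inj₂ y′) → ⊥-elim (¬B y′) })
  least-⊎ (inj₂ ¬A) (inj₁ (y , min-y)) =
    inj₁ (inj₂ y , λ { (inj₁ x′) → ⊥-elim (¬A x′) ; (inj₂ y′) → min-y y′ })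
  least-⊎ (inj₂ ¬A) (inj₂ ¬B) = inj₂ λ { (inj₁ x′) → ¬A x′ ; (inj₂ y′) → ¬B y′ }

  least-× : Least A f → Least B g → Least (A × B) (λ z → f (proj₁ z) + g (proj₂ z))
  least-× (inj₁ (x , min-x)) (inj₁ (y , min-y)) =
    inj₁ ((x , y) , λ z → +-mono-≤ (min-x (proj₁ z)) (min-y (proj₂ z)))
  least-× (inj₂ ¬A) _ = inj₂ (¬A ∘ proj₁)
  least-× (inj₁ _) (inj₂ ¬B) = inj₂ (¬B ∘ proj₂)

  least-transfer : (i : A → B) → (∀ x → g (i x) ≤ f x) →
                   ((y : B) → Σ A λ x → f x ≤ g y) → Least A f → Least B g
  least-transfer i i≤ r (inj₁ (x , min-x)) =
    inj₁ (i x , λ y → ≤-trans (i≤ x) (≤-trans (min-x (proj₁ (r y))) (proj₂ (r y))))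
  least-transfer i i≤ r (inj₂ ¬A) = inj₂ (¬A ∘ proj₁ ∘ r)

least-shift : ∀ {A : Set} {f : A → ℤ} d → Least A f → Least A (λ x → d + f x)
least-shift d (inj₁ (x , min-x)) = inj₁ (x , λ y → +-monoʳ-≤ d (min-x y))
least-shift d (inj₂ ¬A) = inj₂ ¬A

-- Walks in a graph extended by one edge a₀ →d b₀ that closes no negative
-- cycle: every walk is dominated by a route that avoids the new edge or
-- uses it exactly once.
module NewEdge (E : List (Edge n)) (a₀ b₀ : Vertex n) (d : ℤ)
               (closesNoNegCycle : ∀ (q : Walk E b₀ a₀) → + 0 ≤ d + wt q) where

  E⁺ : List (Edge n)
  E⁺ = (a₀ ⟶[ d ] b₀) ∷ E

  Route : Vertex n → Vertex n → Set
  Route a b = Walk E a b ⊎ (Walk E a a₀ × Walk E b₀ b)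

  cost : Route a b → ℤ
  cost = [ wt , (λ r → wt (proj₁ r) + (d + wt (proj₂ r))) ]′

  follow : Route a b → Walk E⁺ a b
  follow (inj₁ q) = weaken q
  follow (inj₂ (q₁ , q₂)) = weaken q₁ ++ᵂ (here refl ∷ᵂ weaken q₂)

  wt-follow : (r : Route a b) → wt (follow r) ≡ cost r
  wt-follow (inj₁ q) = wt-weaken q
  wt-follow (inj₂ (q₁ , q₂)) =
    trans (wt-++ (weaken q₁) _) (cong₂ (λ x y → x + (d + y)) (wt-weaken q₁) (wt-weaken q₂))

  -- A second use of the new edge would traverse a cycle b₀ → a₀ → b₀ of
  -- nonnegative weight, which can be cut out.
  route : (p : Walk E⁺ a b) → Σ (Route a b) λ r → cost r ≤ wt p
  route []ᵂ = inj₁ []ᵂ , ≤-refl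
  route (here refl ∷ᵂ p) with route p
  ... | inj₁ q , q≤p = inj₂ ([]ᵂ , q) , (begin
    + 0 + (d + wt q)  ≡⟨ +-identityˡ _ ⟩
    d + wt q          ≤⟨ +-monoʳ-≤ d q≤p ⟩
    d + wt p          ∎)
    where open ≤-Reasoning
  ... | inj₂ (q₁ , q₂) , le = inj₂ ([]ᵂ , q₂) , (begin
    + 0 + (d + wt q₂)              ≡⟨ +-identityˡ _ ⟩
    d + wt q₂                      ≤⟨ ≤-+ˡ _ (closesNoNegCycle q₁) ⟩
    (d + wt q₁) + (d + wt q₂)      ≡⟨ +-assoc d (wt q₁) _ ⟩
    d + (wt q₁ + (d + wt q₂))      ≤⟨ +-monoʳ-≤ d le ⟩
    d + wt p                       ∎)
    where open ≤-Reasoning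
  route (_∷ᵂ_ {d = d′} (there m) p) with route p
  ... | inj₁ q , le = inj₁ (m ∷ᵂ q) , +-monoʳ-≤ d′ le
  ... | inj₂ (q₁ , q₂) , le =
    inj₂ (m ∷ᵂ q₁ , q₂) , ≤-trans (≤-reflexive (+-assoc d′ (wt q₁) _)) (+-monoʳ-≤ d′ le)

_≟ᵛ_ : DecidableEquality (Vertex n)
pos x ≟ᵛ pos y with x Fin.≟ y
... | yes refl = yes refl
... | no  x≢y  = no λ { refl → x≢y refl }
neg x ≟ᵛ neg y with x Fin.≟ y
... | yes refl = yes refl
... | no  x≢y  = no λ { refl → x≢y refl }
pos x ≟ᵛ neg y = no λ ()
neg x ≟ᵛ pos y = no λ ()

-- By induction on the edge list: walks of
-- e ∷ E correspond, up to domination, to routes through E.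
shortest : ∀ (E : List (Edge n)) → NoNeg E → ∀ a b → Least (Walk E a b) wt
shortest [] _ a b with a ≟ᵛ b
... | yes refl = inj₁ ([]ᵂ , λ { []ᵂ → ≤-refl ; (() ∷ᵂ _) })
... | no  a≢b  = inj₂ λ { []ᵂ → a≢b refl ; (() ∷ᵂ _) }
shortest ((a₀ ⟶[ d ] b₀) ∷ E) noNeg a b =
  least-transfer follow (λ r → ≤-reflexive (wt-follow r)) route
    (least-⊎ (shortest E noNeg′ a b)
             (least-× (shortest E noNeg′ a a₀) (least-shift d (shortest E noNeg′ b₀ b))))
  where
  noNeg′ : NoNeg E
  noNeg′ = noNeg-tail noNeg
  closes : ∀ (q : Walk E b₀ a₀) → + 0 ≤ d + wt q
  closes q = subst (λ z → + 0 ≤ d + z) (wt-weaken q) (noNeg a₀ (here refl ∷ᵂ weaken q))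
  open NewEdge E a₀ b₀ d closes

co-involutive : ∀ (v : Vertex n) → co (co v) ≡ v
co-involutive (pos x) = refl
co-involutive (neg x) = refl

Symmetric : List (Edge n) → Set
Symmetric E = ∀ {a d b} → (a ⟶[ d ] b) ∈ E → (co b ⟶[ d ] co a) ∈ E

mirror : Symmetric E → Walk E a b → Walk E (co b) (co a)
mirror symE []ᵂ = []ᵂ
mirror symE (m ∷ᵂ p) = mirror symE p ++ᵂ (symE m ∷ᵂ []ᵂ)

wt-mirror : (symE : Symmetric E) (p : Walk E a b) → wt (mirror symE p) ≡ wt p
wt-mirror symE []ᵂ = refl
wt-mirror symE (_∷ᵂ_ {d = d} m p) = begin
  wt (mirror symE p ++ᵂ (symE m ∷ᵂ []ᵂ))  ≡⟨ wt-++ (mirror symE p) _ ⟩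
  wt (mirror symE p) + (d + + 0)          ≡⟨ cong₂ _+_ (wt-mirror symE p) (+-identityʳ d) ⟩
  wt p + d                                ≡⟨ +-comm (wt p) d ⟩
  d + wt p                                ∎
  where open ≡-Reasoning

mirrorᶜ : Symmetric E → ∀ {a b} → Walk E (co a) (co b) → Walk E b a
mirrorᶜ symE p = retarget (co-involutive _) (co-involutive _) (mirror symE p)

wt-mirrorᶜ : (symE : Symmetric E) → ∀ {a b} (p : Walk E (co a) (co b)) →
             wt (mirrorᶜ symE p) ≡ wt p
wt-mirrorᶜ symE p =
  trans (wt-retarget (co-involutive _) (co-involutive _) (mirror symE p)) (wt-mirror symE p)

-- ρ(v) + ρ(-v) ≥ 0 at v, stated for all walks rather than least ones.
TightAt : List (Edge n) → Vertex n → Set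
TightAt E v = ∀ (p : Walk E v (co v)) (q : Walk E (co v) (co (co v))) →
              + 0 ≤ ⌊ wt p /2⌋ + ⌊ wt q /2⌋

Tight : List (Edge n) → Set
Tight E = ∀ v → TightAt E v

tight-from-pos : (∀ x → TightAt E (pos x)) → Tight E
tight-from-pos tightPos (pos x) p q = tightPos x p q
tight-from-pos tightPos (neg x) p q =
  subst (+ 0 ≤_) (+-comm ⌊ wt q /2⌋ ⌊ wt p /2⌋) (tightPos x q p)

-- The invariant maintained while tightening the graph.
Consistent : List (Edge n) → Set
Consistent E = Symmetric E × NoNeg E × Tight E

-- Adding the bound edge u →2k -u (for u = x⁻ it encodes x ≤ k, for u = x⁺
-- it encodes -x ≤ k) to a consistent graph keeps it consistent, provided
-- the edge closes no negative cycle.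
module AddBound {E : List (Edge n)} (u : Vertex n) (k : ℤ)
                (symE : Symmetric E) (noNeg : NoNeg E) (tight : Tight E)
                (closes : ∀ (q : Walk E (co u) u) → + 0 ≤ + 2 * k + wt q) where

  open NewEdge E u (co u) (+ 2 * k) closes public

  -- The new edge is its own mirror.
  symmetric⁺ : Symmetric E⁺
  symmetric⁺ (here refl) = here (cong (λ w → w ⟶[ + 2 * k ] co u) (co-involutive u))
  symmetric⁺ (there m) = there (symE m)

  -- A cycle through the new edge is q₁ : v → u, the edge, q₂ : -u → v,
  -- and q₂ ++ q₁ is a cycle closed by the new edge.
  noNeg⁺ : NoNeg E⁺
  noNeg⁺ v p with route p
  ... | inj₁ q , q≤p = ≤-trans (noNeg v q) q≤p
  ... | inj₂ (q₁ , q₂) , le = ≤-trans (subst (+ 0 ≤_) rotate (closes (q₂ ++ᵂ q₁))) le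
    where
    rotate : + 2 * k + wt (q₂ ++ᵂ q₁) ≡ wt q₁ + (+ 2 * k + wt q₂)
    rotate = trans (cong (λ z → + 2 * k + z) (wt-++ q₂ q₁)) (swap (+ 2 * k) (wt q₁) (wt q₂))
      where
      swap : ∀ c x y → c + (y + x) ≡ x + (c + y)
      swap = solve-∀

  halve : ∀ {z x y w} → z ≤ x → z ≤ y → x + (+ 2 * k + y) ≤ w → z + k ≤ ⌊ w /2⌋
  halve {z} {x} {y} {w} z≤x z≤y h = ⌊/2⌋-greatest w (begin
    + 2 * (z + k)       ≡⟨ twice z k ⟩
    z + (+ 2 * k + z)   ≤⟨ +-mono-≤ z≤x (+-monoʳ-≤ (+ 2 * k) z≤y) ⟩
    x + (+ 2 * k + y)   ≤⟨ h ⟩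
    w                   ∎)
    where
    open ≤-Reasoning
    twice : ∀ z k → + 2 * (z + k) ≡ z + (+ 2 * k + z)
    twice = solve-∀

  -- A walk v → -v of E⁺ is dominated by one of E, or it uses the new edge,
  -- and then ⌊ w /2⌋ ≥ wt Q + k for a walk Q : v → u of E (the shorter of
  -- its part before the edge and the mirror of its part after the edge).
  complement : (p : Walk E⁺ v (co v)) →
    (Σ (Walk E v (co v)) λ p′ → wt p′ ≤ wt p) ⊎
    (Σ (Walk E v u) λ Q → wt Q + k ≤ ⌊ wt p /2⌋)
  complement {v = v} p with route p
  ... | inj₁ p′ , p′≤p = inj₁ (p′ , p′≤p)
  ... | inj₂ (q₁ , q₂) , le with wt q₁ ≤? wt q₂
  ...   | yes q₁≤q₂ = inj₂ (q₁ , halve ≤-refl q₁≤q₂ le)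
  ...   | no  q₁≰q₂ = inj₂ (mirrorᶜ symE {u} {v} q₂ ,
          halve (≤-trans (≤-reflexive (wt-mirrorᶜ symE {u} {v} q₂)) (<⇒≤ (≰⇒> q₁≰q₂)))
                (≤-reflexive (wt-mirrorᶜ symE {u} {v} q₂)) le)

  -- Q : a → u and q : -a → a close the cycle mirror Q ++ q ++ Q through
  -- the new edge, so ⌊ wt q /2⌋ ≥ -(wt Q + k).
  opposite-bound : (Q : Walk E a u) (q : Walk E (co a) a) → - (wt Q + k) ≤ ⌊ wt q /2⌋
  opposite-bound Q q =
    ⌊/2⌋-greatest (wt q) (0≤i-j⇒j≤i (subst (+ 0 ≤_) balance (closes cycle)))
    where
    cycle : Walk E (co u) u
    cycle = mirror symE Q ++ᵂ (q ++ᵂ Q)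
    balance : + 2 * k + wt cycle ≡ wt q - + 2 * (- (wt Q + k))
    balance = begin
      + 2 * k + wt cycle                ≡⟨ cong (λ z → + 2 * k + z) wt-cycle ⟩
      + 2 * k + (wt Q + (wt q + wt Q))  ≡⟨ regroup k (wt Q) (wt q) ⟩
      wt q - + 2 * (- (wt Q + k))       ∎
      where
      open ≡-Reasoning
      wt-cycle : wt cycle ≡ wt Q + (wt q + wt Q)
      wt-cycle = trans (wt-++ (mirror symE Q) _) (cong₂ _+_ (wt-mirror symE Q) (wt-++ q Q))
      regroup : ∀ k x y → + 2 * k + (x + (y + x)) ≡ y - + 2 * (- (x + k))
      regroup = solve-∀

  -- Q : a → u and R : -a → u close the cycle mirror R ++ Q through the new edge.
  both-bound : (Q : Walk E a u) (R : Walk E (co a) u) → + 0 ≤ (wt Q + k) + (wt R + k)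
  both-bound {a = a} Q R = subst (+ 0 ≤_) balance (closes cycle)
    where
    R̄ : Walk E (co u) a
    R̄ = retarget refl (co-involutive a) (mirror symE R)
    cycle : Walk E (co u) u
    cycle = R̄ ++ᵂ Q
    balance : + 2 * k + wt cycle ≡ (wt Q + k) + (wt R + k)
    balance = begin
      + 2 * k + wt cycle       ≡⟨ cong (λ z → + 2 * k + z) wt-cycle ⟩
      + 2 * k + (wt R + wt Q)  ≡⟨ regroup k (wt Q) (wt R) ⟩
      (wt Q + k) + (wt R + k)  ∎
      where
      open ≡-Reasoning
      wt-cycle : wt cycle ≡ wt R + wt Q
      wt-cycle = trans (wt-++ R̄ Q) (cong (_+ wt Q)
        (trans (wt-retarget refl (co-involutive a) (mirror symE R)) (wt-mirror symE R)))
      regroup : ∀ k x y → + 2 * k + (y + x) ≡ (x + k) + (y + k)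
      regroup = solve-∀

  tight⁺ : Tight E⁺
  tight⁺ v p q with complement p | complement q
  ... | inj₁ (p′ , p′≤p) | inj₁ (q′ , q′≤q) =
    0≤-sum (tight v p′ q′) (⌊/2⌋-mono p′≤p) (⌊/2⌋-mono q′≤q)
  ... | inj₂ (Q , Q≤p) | inj₁ (q′ , q′≤q) =
    0≤-sum (≤-reflexive (sym (+-inverseʳ (wt Q + k)))) Q≤p
      (≤-trans (opposite-bound Q q̄) (⌊/2⌋-mono q̄≤q))
    where
    q̄ : Walk E (co v) v
    q̄ = retarget refl (co-involutive v) q′
    q̄≤q : wt q̄ ≤ wt q
    q̄≤q = ≤-trans (≤-reflexive (wt-retarget refl (co-involutive v) q′)) q′≤q
  ... | inj₁ (p′ , p′≤p) | inj₂ (R , R≤q) =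
    0≤-sum (≤-reflexive (sym (+-inverseˡ (wt R + k))))
      (≤-trans (opposite-bound R p̄) (⌊/2⌋-mono p̄≤p)) R≤q
    where
    p̄ : Walk E (co (co v)) (co v)
    p̄ = retarget (sym (co-involutive v)) refl p′
    p̄≤p : wt p̄ ≤ wt p
    p̄≤p = ≤-trans (≤-reflexive (wt-retarget (sym (co-involutive v)) refl p′)) p′≤p
  ... | inj₂ (Q , Q≤p) | inj₂ (R , R≤q) = 0≤-sum (both-bound Q R) Q≤p R≤q

-- x is pinned to t in E: E contains the bound edges of x ≤ t and -x ≤ -t.
Pinned : List (Edge n) → Fin n → ℤ → Set
Pinned E x t = (neg x ⟶[ + 2 * t ] pos x) ∈ E × (pos x ⟶[ + 2 * (- t) ] neg x) ∈ E

cycle-bound : ∀ {s t w} → + 0 ≤ s + t → + 2 * s ≤ w → + 0 ≤ + 2 * t + w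
cycle-bound {s} {t} {w} 0≤s+t 2s≤w = begin
  + 0                    ≤⟨ *-monoˡ-≤-nonNeg (+ 2) 0≤s+t ⟩
  + 2 * (s + t)          ≡⟨ *-distribˡ-+ (+ 2) s t ⟩
  + 2 * s + + 2 * t      ≤⟨ +-monoˡ-≤ (+ 2 * t) 2s≤w ⟩
  w + + 2 * t            ≡⟨ +-comm w (+ 2 * t) ⟩
  + 2 * t + w            ∎
  where open ≤-Reasoning

-- The value is ρ(x⁻) when it is finite, else -ρ(x⁺), else arbitrary.
admissible : ∀ {E : List (Edge n)} → NoNeg E → Tight E → ∀ x → Σ ℤ λ t →
  (∀ (q : Walk E (pos x) (neg x)) → + 0 ≤ + 2 * t + wt q) ×
  (∀ (q : Walk E (neg x) (pos x)) → + 2 * t ≤ wt q)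
admissible {E = E} noNeg tight x
  with shortest E noNeg (neg x) (pos x) | shortest E noNeg (pos x) (neg x)
... | inj₁ (m , min-m) | _ = ⌊ wt m /2⌋
    , (λ q → cycle-bound (tight (pos x) q m) (proj₁ (floorHalf (wt q))))
    , (λ q → ≤-trans (proj₁ (floorHalf (wt m))) (min-m q))
... | inj₂ ¬m | inj₁ (m , min-m) = - ⌊ wt m /2⌋
    , (λ q → cycle-bound (≤-reflexive (sym (+-inverseʳ ⌊ wt m /2⌋)))
                         (≤-trans (proj₁ (floorHalf (wt m))) (min-m q)))
    , (⊥-elim ∘ ¬m)
... | inj₂ ¬m | inj₂ ¬m′ = + 0 , (⊥-elim ∘ ¬m′) , (⊥-elim ∘ ¬m)

-- Pinning one variable to an admissible value keeps the graph consistent: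
-- first add x ≤ t, then -x ≤ -t.
pin : ∀ {E : List (Edge n)} → Consistent E → ∀ x →
  Σ (List (Edge n)) λ E′ → Consistent E′ × (∀ {e} → e ∈ E → e ∈ E′) × Σ ℤ (Pinned E′ x)
pin {E = E} (symE , noNeg , tight) x with admissible noNeg tight x
... | t , lowerOK , upperOK =
  Second.E⁺ , (Second.symmetric⁺ , Second.noNeg⁺ , Second.tight⁺) , there ∘ there ,
  t , there (here refl) , here refl
  where
  module First = AddBound (neg x) t symE noNeg tight lowerOK
  -- After adding x ≤ t, walks x⁻ → x⁺ still weigh at least 2t: a walk using
  -- the new edge consists of it and two cycles.
  atLeast : ∀ (q : Walk First.E⁺ (neg x) (pos x)) → + 2 * t ≤ wt q
  atLeast q with First.route q
  ... | inj₁ q′ , le = ≤-trans (upperOK q′) le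
  ... | inj₂ (q₁ , q₂) , le = ≤-trans (begin
    + 2 * t                  ≤⟨ ≤-+ˡ _ (noNeg _ q₂) ⟩
    wt q₂ + + 2 * t          ≡⟨ +-comm (wt q₂) _ ⟩
    + 2 * t + wt q₂          ≤⟨ ≤-+ˡ _ (noNeg _ q₁) ⟩
    wt q₁ + (+ 2 * t + wt q₂) ∎) le
    where open ≤-Reasoning
  upperOK₁ : ∀ (q : Walk First.E⁺ (neg x) (pos x)) → + 0 ≤ + 2 * (- t) + wt q
  upperOK₁ q = cycle-bound (≤-reflexive (sym (+-inverseʳ t))) (atLeast q)
  module Second = AddBound (pos x) (- t) First.symmetric⁺ First.noNeg⁺ First.tight⁺ upperOK₁

pinAll : ∀ {E : List (Edge n)} → Consistent E → ∀ (xs : List (Fin n)) →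
  Σ (List (Edge n)) λ E′ → Consistent E′ × (∀ {e} → e ∈ E → e ∈ E′) ×
                           (∀ x → x ∈ xs → Σ ℤ (Pinned E′ x))
pinAll consistent [] = _ , consistent , (λ m → m) , λ x ()
pinAll consistent (x ∷ xs) with pin consistent x
... | E₁ , consistent₁ , E⊆E₁ , t , pinned with pinAll consistent₁ xs
...   | E′ , consistent′ , E₁⊆E′ , pins =
  E′ , consistent′ , (λ m → E₁⊆E′ (E⊆E₁ m)) , pins′
  where
  pins′ : ∀ y → y ∈ x ∷ xs → Σ ℤ (Pinned E′ y)
  pins′ y (here refl) = t , E₁⊆E′ (proj₁ pinned) , E₁⊆E′ (proj₂ pinned)
  pins′ y (there y∈xs) = pins y y∈xs

val : (Fin n → ℤ) → Vertex n → ℤ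
val σ (pos x) = σ x
val σ (neg x) = - σ x

val-co : ∀ (σ : Fin n → ℤ) v → val σ (co v) ≡ - val σ v
val-co σ (pos x) = refl
val-co σ (neg x) = sym (neg-involutive (σ x))

Respects : (Fin n → ℤ) → Edge n → Set
Respects σ (a ⟶[ d ] b) = val σ b - val σ a ≤ d

respects-mirror : ∀ {σ : Fin n → ℤ} {d} →
                  Respects σ (a ⟶[ d ] b) → Respects σ (co b ⟶[ d ] co a)
respects-mirror {a = a} {b = b} {σ = σ} = subst (_≤ _) (sym (begin
  val σ (co a) - val σ (co b)  ≡⟨ cong₂ (λ x y → x - y) (val-co σ a) (val-co σ b) ⟩
  - val σ a - - val σ b        ≡⟨ flip (val σ a) (val σ b) ⟩
  val σ b - val σ a            ∎))
  where
  open ≡-Reasoning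
  flip : ∀ x y → - x - - y ≡ y - x
  flip = solve-∀

walk-potential : ∀ {σ : Fin n → ℤ} → (∀ {e} → e ∈ E → Respects σ e) →
                 (p : Walk E a b) → val σ b - val σ a ≤ wt p
walk-potential {a = a} {σ = σ} respects []ᵂ = ≤-reflexive (+-inverseʳ (val σ a))
walk-potential {a = a} {b = b} {σ = σ} respects (_∷ᵂ_ {d = d} {w = w} m p) = begin
  val σ b - val σ a                          ≡⟨ telescope (val σ a) (val σ w) (val σ b) ⟩
  (val σ w - val σ a) + (val σ b - val σ w)  ≤⟨ +-mono-≤ (respects m) (walk-potential respects p) ⟩
  d + wt p                                   ∎
  where
  open ≤-Reasoning
  telescope : ∀ x y z → z - x ≡ (y - x) + (z - y)
  telescope = solve-∀

-- If every variable is pinned in a symmetric graph without negative cycles,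
-- the pinned values respect every edge a →d b: the edge, its mirror and the
-- pins x⁻ ↔ x⁺ of its endpoints form a cycle of weight 2d - 2(val b - val a).
pinned-respects : Symmetric E → NoNeg E → (pins : ∀ x → Σ ℤ (Pinned E x)) →
                  ∀ {e} → e ∈ E → Respects (proj₁ ∘ pins) e
pinned-respects {E = E} symE noNeg pins {a ⟶[ d ] b} m =
  *-cancelˡ-≤-pos (val σ b - val σ a) d (+ 2)
    (0≤i-j⇒j≤i (subst (+ 0 ≤_) balance (noNeg (co a) cycle)))
  where
  σ : _ → ℤ
  σ = proj₁ ∘ pins
  up : ∀ a → (co a ⟶[ + 2 * val σ a ] a) ∈ E
  up (pos x) = proj₁ (proj₂ (pins x))
  up (neg x) = proj₂ (proj₂ (pins x))
  down : ∀ b → (b ⟶[ + 2 * val σ (co b) ] co b) ∈ E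
  down (pos x) = proj₂ (proj₂ (pins x))
  down (neg x) = proj₁ (proj₂ (pins x))
  cycle : Walk E (co a) (co a)
  cycle = up a ∷ᵂ m ∷ᵂ down b ∷ᵂ symE m ∷ᵂ []ᵂ
  balance : wt cycle ≡ + 2 * d - + 2 * (val σ b - val σ a)
  balance = begin
    + 2 * val σ a + (d + (+ 2 * val σ (co b) + (d + + 0)))
      ≡⟨ cong (λ z → + 2 * val σ a + (d + (+ 2 * z + (d + + 0)))) (val-co σ b) ⟩
    + 2 * val σ a + (d + (+ 2 * - val σ b + (d + + 0)))
      ≡⟨ regroup (val σ a) (val σ b) d ⟩
    + 2 * d - + 2 * (val σ b - val σ a)
      ∎
    where
    open ≡-Reasoning
    regroup : ∀ x y d → + 2 * x + (d + (+ 2 * - y + (d + + 0))) ≡ + 2 * d - + 2 * (y - x)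
    regroup = solve-∀

twice-pos : ∀ x → x - - x ≡ + 2 * x
twice-pos = solve-∀

twice-neg : ∀ x → - x - x ≡ + 2 * (- x)
twice-neg = solve-∀

-- A constraint holds iff its edges are respected (the first edge already
-- encodes it, the second is the mirror of the first).
sat⇒respects : ∀ {σ : Fin n → ℤ} c → σ ⊨ c → ∀ {e} → e ∈ edgesOf c → Respects σ e
sat⇒respects (diff x y _ d) h (here refl) = h
sat⇒respects {σ = σ} (diff x y _ d) h (there (here refl)) =
  respects-mirror {a = pos y} {b = pos x} {σ = σ} h
sat⇒respects {σ = σ} (sum x y _ d) h (here refl) =
  subst (λ z → σ x + z ≤ d) (sym (neg-involutive (σ y))) h
sat⇒respects {σ = σ} (sum x y c d) h (there (here refl)) =
  respects-mirror {a = neg y} {b = pos x} {σ = σ} (sat⇒respects {σ = σ} (sum x y c d) h (here refl))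
sat⇒respects (negsum x y _ d) h (here refl) = h
sat⇒respects {σ = σ} (negsum x y _ d) h (there (here refl)) =
  respects-mirror {a = pos y} {b = neg x} {σ = σ} h
sat⇒respects {σ = σ} (upper x d) h (here refl) =
  subst (_≤ + 2 * d) (sym (twice-pos (σ x))) (*-monoˡ-≤-nonNeg (+ 2) h)
sat⇒respects {σ = σ} (lower x d) h (here refl) =
  subst (_≤ + 2 * d) (sym (twice-neg (σ x))) (*-monoˡ-≤-nonNeg (+ 2) h)

respects⇒sat : ∀ {σ : Fin n → ℤ} c → (∀ {e} → e ∈ edgesOf c → Respects σ e) → σ ⊨ c
respects⇒sat (diff x y _ d) respects = respects (here refl)
respects⇒sat {σ = σ} (sum x y _ d) respects =
  subst (λ z → σ x + z ≤ d) (neg-involutive (σ y)) (respects (here refl))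
respects⇒sat (negsum x y _ d) respects = respects (here refl)
respects⇒sat {σ = σ} (upper x d) respects =
  *-cancelˡ-≤-pos (σ x) d (+ 2) (subst (_≤ + 2 * d) (twice-pos (σ x)) (respects (here refl)))
respects⇒sat {σ = σ} (lower x d) respects =
  *-cancelˡ-≤-pos (- σ x) d (+ 2) (subst (_≤ + 2 * d) (twice-neg (σ x)) (respects (here refl)))

edgesOf-symmetric : ∀ (c : Constraint n) → Symmetric (edgesOf c)
edgesOf-symmetric (diff x y _ d)   (here refl)         = there (here refl)
edgesOf-symmetric (diff x y _ d)   (there (here refl)) = here refl
edgesOf-symmetric (sum x y _ d)    (here refl)         = there (here refl)
edgesOf-symmetric (sum x y _ d)    (there (here refl)) = here refl
edgesOf-symmetric (negsum x y _ d) (here refl)         = there (here refl)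
edgesOf-symmetric (negsum x y _ d) (there (here refl)) = here refl
edgesOf-symmetric (upper x d)      (here refl)         = here refl
edgesOf-symmetric (lower x d)      (here refl)         = here refl

edge-source : ∀ {φ : List (Constraint n)} {e} → e ∈ edges φ →
              ∃ λ c → c ∈ φ × e ∈ edgesOf c
edge-source {φ = φ} e∈φ = find (∈-concatMap⁻ edgesOf {xs = φ} e∈φ)

edge-of : ∀ {φ : List (Constraint n)} {c e} → c ∈ φ → e ∈ edgesOf c → e ∈ edges φ
edge-of {φ = φ} c∈φ e∈c = ∈-concatMap⁺ edgesOf {xs = φ} (lose c∈φ e∈c)

edges-symmetric : ∀ (φ : List (Constraint n)) → Symmetric (edges φ)
edges-symmetric φ e∈φ with edge-source {φ = φ} e∈φ
... | c , c∈φ , e∈c = edge-of c∈φ (edgesOf-symmetric c e∈c)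

toWalk : ∀ {φ : List (Constraint n)} → Path φ a b → Walk (edges φ) a b
toWalk [] = []ᵂ
toWalk (m ∷ p) = m ∷ᵂ toWalk p

fromWalk : ∀ {φ : List (Constraint n)} → Walk (edges φ) a b → Path φ a b
fromWalk []ᵂ = []
fromWalk (m ∷ᵂ p) = m ∷ fromWalk p

wt-toWalk : ∀ {φ : List (Constraint n)} (p : Path φ a b) → wt (toWalk p) ≡ weight p
wt-toWalk [] = refl
wt-toWalk (_∷_ {d = d} _ p) = cong (λ z → d + z) (wt-toWalk p)

wt-fromWalk : ∀ {φ : List (Constraint n)} (p : Walk (edges φ) a b) →
              weight (fromWalk {φ = φ} p) ≡ wt p
wt-fromWalk []ᵂ = refl
wt-fromWalk {φ = φ} (_∷ᵂ_ {d = d} _ p) = cong (λ z → d + z) (wt-fromWalk {φ = φ} p)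

NegativeBounds : List (Constraint n) → Set
NegativeBounds {n} φ = Σ (Vertex n) λ v → Σ ℤ λ r₁ → Σ ℤ λ r₂ →
                       IsRho φ v r₁ × IsRho φ (co v) r₂ × r₁ + r₂ < + 0

-- An integer solution σ bounds ρ below by the potential: ρ(v) ≥ -val σ v,
-- since every path v → -v weighs at least val σ (-v) - val σ v = -2 val σ v.
rho-bound : ∀ {φ : List (Constraint n)} {σ r} → All (σ ⊨_) φ → IsRho φ v r → - val σ v ≤ r
rho-bound {v = v} {φ = φ} {σ = σ} sat (w , ((p , wp≡w) , _) , floor) =
  floorHalf-greatest floor (begin
  + 2 * (- val σ v)         ≡⟨ twice-neg (val σ v) ⟨
  - val σ v - val σ v       ≡⟨ cong (_- val σ v) (val-co σ v) ⟨
  val σ (co v) - val σ v    ≤⟨ walk-potential respects (toWalk p) ⟩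
  wt (toWalk p)             ≡⟨ wt-toWalk p ⟩
  weight p                  ≡⟨ wp≡w ⟩
  w                         ∎)
  where
  open ≤-Reasoning
  respects : ∀ {e} → e ∈ edges φ → Respects σ e
  respects e∈φ with edge-source {φ = φ} e∈φ
  ... | c , c∈φ , e∈c = sat⇒respects c (All.lookup sat c∈φ) e∈c

sound : ∀ (φ : List (Constraint n)) → NegativeBounds φ → ¬ SatZ φ
sound φ (v , r₁ , r₂ , ρv , ρ-v , negative) (σ , sat) =
  <⇒≱ negative (0≤-sum cancel (rho-bound sat ρv) (rho-bound sat ρ-v))
  where
  cancel : + 0 ≤ - val σ v + - val σ (co v)
  cancel = ≤-reflexive (sym (begin
    - val σ v + - val σ (co v)   ≡⟨ cong (λ z → - val σ v + - z) (val-co σ v) ⟩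
    - val σ v + - - val σ v      ≡⟨ +-inverseʳ (- val σ v) ⟩
    + 0                          ∎))
    where open ≡-Reasoning

-- A consistent constraint graph has an integer solution: pin every variable
-- and read the solution off the pins.
solution : ∀ (φ : List (Constraint n)) → Consistent (edges φ) → SatZ φ
solution {n} φ consistent with pinAll consistent (allFin n)
... | E′ , (symE′ , noNeg′ , _) , φ⊆E′ , pins =
  proj₁ ∘ pins′ , All.tabulate λ {c} c∈φ → respects⇒sat c λ e∈c →
    pinned-respects symE′ noNeg′ pins′ (φ⊆E′ (edge-of c∈φ e∈c))
  where
  pins′ : ∀ x → Σ ℤ (Pinned E′ x)
  pins′ x = pins x (∈-allFin x)

finSearch : ∀ {m} {A : Set} {B : Fin m → Set} → (∀ x → A ⊎ B x) → A ⊎ (∀ x → B x)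
finSearch {zero} decide = inj₂ λ ()
finSearch {suc m} decide with decide Fin.zero | finSearch (decide ∘ Fin.suc)
... | inj₁ a | _      = inj₁ a
... | inj₂ _ | inj₁ a = inj₁ a
... | inj₂ b | inj₂ bs = inj₂ λ { Fin.zero → b ; (Fin.suc x) → bs x }

module Completeness (φ : List (Constraint n)) (noNegCycle : NoNegCycle φ) where

  noNeg : NoNeg (edges φ)
  noNeg v p = subst (+ 0 ≤_) (wt-fromWalk {φ = φ} p) (noNegCycle v (fromWalk p))

  rho : ∀ v (p : Walk (edges φ) v (co v)) → (∀ q → wt p ≤ wt q) → IsRho φ v ⌊ wt p /2⌋
  rho v p min-p = wt p ,
    ((fromWalk p , wt-fromWalk {φ = φ} p) ,
     λ q → subst (wt p ≤_) (wt-toWalk q) (min-p (toWalk q))) ,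
    floorHalf (wt p)

  checkVariable : ∀ x → NegativeBounds φ ⊎ TightAt (edges φ) (pos x)
  checkVariable x
    with shortest (edges φ) noNeg (pos x) (neg x) | shortest (edges φ) noNeg (neg x) (pos x)
  ... | inj₂ ¬p | _ = inj₂ λ p _ → ⊥-elim (¬p p)
  ... | inj₁ _ | inj₂ ¬q = inj₂ λ _ q → ⊥-elim (¬q q)
  ... | inj₁ (p , min-p) | inj₁ (q , min-q) with ⌊ wt p /2⌋ + ⌊ wt q /2⌋ <? + 0
  ...   | yes negative =
          inj₁ (pos x , _ , _ , rho (pos x) p min-p , rho (neg x) q min-q , negative)
  ...   | no ¬negative = inj₂ λ p′ q′ →
          ≤-trans (≮⇒≥ ¬negative) (+-mono-≤ (⌊/2⌋-mono (min-p p′)) (⌊/2⌋-mono (min-q q′)))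

  complete : ¬ SatZ φ → NegativeBounds φ
  complete unsat with finSearch checkVariable
  ... | inj₁ negative = negative
  ... | inj₂ tightPos =
    ⊥-elim (unsat (solution φ (edges-symmetric φ , noNeg , tight-from-pos tightPos)))

theorem3 : ∀ {n : ℕ} (φ : List (Constraint n)) → NoNegCycle φ →
    (¬ SatZ φ) ⇔ (Σ (Vertex n) λ v → Σ ℤ λ r₁ → Σ ℤ λ r₂ →
                    IsRho φ v r₁ × IsRho φ (co v) r₂ × r₁ + r₂ < + 0)
theorem3 φ noNegCycle = mk⇔ (Completeness.complete φ noNegCycle) (sound φ)
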